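{- Let $K\ge1$ and $\sigma\in\widehat\Sigma^\star$. There exists a tree $t\in T^K_\Sigma$ with $C(t)=\sigma$ if and only if $\sigma=\sigma_0\sigma_1\cdots\sigma_n$ for some $n\ge0$ and $\sigma_0,\dots,\sigma_n\in\widehat\Sigma^K$ such that (a) for each $0\le\ell\le n$, $\sigma_\ell=\alpha_{\ell,1}\cdots\alpha_{\ell,s_\ell}\$^{K-s_\ell}$ for some $s_\ell\ge1$ and $\alpha_{\ell,1},\dots,\alpha_{\ell,s_\ell}\in\Sigma\times\{0,1\}$; and (b) writing $\alpha_{\ell,r}=\langle a_{\ell,r},c_{\ell,r}\rangle$, we have $s_0=1$, $s_{\ell+1}=2(c_{\ell,1}+\dots+c_{\ell,s_\ell})$ for $0\le\ell<n$, and $c_{n,1}+\dots+c_{n,s_n}=0$.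
   Context: A tree domain is a non-empty finite prefix-closed $D\subseteq\{0,1\}^\star$ with $u0\in D$ iff $u1\in D$ for all $u\in D$; a tree over the finite alphabet $\Sigma$ is a map $t\colon D\to\Sigma$ with $\operatorname{dom}(t)=D$. Thickness is $\max_\ell|\operatorname{dom}(t)\cap\{0,1\}^\ell|$, height $h(t)=\max\{|u|:u\in\operatorname{dom}(t)\}$, $T^K_\Sigma$ is the set of trees of thickness $\le K$. Encoding: let $\$$ be a new symbol and $\widehat\Sigma=\Sigma\times\{0,1\}\cup\{\$\}$. For $t\in T^K_\Sigma$ with $m=h(t)$, $C(t)=\sigma_0\sigma_1\cdots\sigma_m$ where, with $u_{\ell,1},\dots,u_{\ell,s_\ell}$ the lexicographic (with $0<1$) enumeration of $\operatorname{dom}(t)\cap\{0,1\}^\ell$, $c_{\ell,r}=1$ if $u_{\ell,r}0,u_{\ell,r}1\in\operatorname{dom}(t)$ and $c_{\ell,r}=0$ otherwise, and $\sigma_\ell=\langle t(u_{\ell,1}),c_{\ell,1}\rangle\cdots\langle t(u_{\ell,s_\ell}),c_{\ell,s_\ell}\rangle\$^{K-s_\ell}$. -}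

module Defs where

open import Data.Nat using (ℕ; zero; suc; _∸_; _⊔_)
open import Data.Bool using (Bool; true; false; if_then_else_)
open import Data.List using (List; []; _∷_; _++_; map; concat; replicate; length; upTo; foldr)
open import Data.Nat.ListAction using (sum)
open import Data.Product using (_×_; _,_; proj₁; proj₂; ∃)
open import Data.Fin using (Fin)
open import Function.Bundles using (_↔_)

Finite : Set → Set
Finite A = ∃ λ k → A ↔ Fin k

-- Node at address u ∈ {0,1}* : the root is ε, the left child of u is u0, right is u1.
-- This is exactly a map t : D → Σ on a finite nonempty prefix-closed D with u0∈D ⇔ u1∈D.
data Tree (Σ : Set) : Set where
  leaf : Σ → Tree Σ
  node : Σ → Tree Σ → Tree Σ → Tree Σ

label : ∀ {Σ} → Tree Σ → Σ
label (leaf a)     = a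
label (node a _ _) = a

hasChildren : ∀ {Σ} → Tree Σ → Bool
hasChildren (leaf _)     = false
hasChildren (node _ _ _) = true

height : ∀ {Σ} → Tree Σ → ℕ
height (leaf _)     = 0
height (node _ l r) = suc (height l ⊔ height r)

-- Nodes at depth ℓ, in lexicographic order of addresses (0 < 1),
-- each given as ⟨ t(u) , c ⟩ with c = true iff u0,u1 ∈ dom(t).
level : ∀ {Σ} → Tree Σ → ℕ → List (Σ × Bool)
level t zero                  = (label t , hasChildren t) ∷ []
level (leaf _)     (suc ℓ)    = []
level (node _ l r) (suc ℓ)    = level l ℓ ++ level r ℓ

thickness : ∀ {Σ} → Tree Σ → ℕ
thickness t = foldr _⊔_ 0 (map (λ ℓ → length (level t ℓ)) (upTo (suc (height t))))

data Hat (Σ : Set) : Set where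
  sym    : Σ → Bool → Hat Σ
  dollar : Hat Σ

toHat : ∀ {Σ} → Σ × Bool → Hat Σ
toHat (a , c) = sym a c

block : ∀ {Σ} → ℕ → List (Σ × Bool) → List (Hat Σ)
block K α = map toHat α ++ replicate (K ∸ length α) dollar

encode : ∀ {Σ} → ℕ → Tree Σ → List (Hat Σ)
encode K t = concat (map (λ ℓ → block K (level t ℓ)) (upTo (suc (height t))))

bit : Bool → ℕ
bit c = if c then 1 else 0

csum : {Σ : Set} → List (Σ × Bool) → ℕ
csum {Σ} α = sum (map (λ (p : Σ × Bool) → bit (proj₂ p)) α)

module Submission where

-- A tree is rebuilt from its level sequence bottom-up: the nodes of level ℓ are
-- read left to right, and each node marked 1 takes the next two trees of the
-- forest already built for level ℓ + 1 as its children.  The counting condition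
-- s_{ℓ+1} = 2 (c_{ℓ,1} + ⋯ + c_{ℓ,s_ℓ}) says exactly that this forest has the
-- right number of trees, and s_0 = 1 makes the final forest a single tree.

open import Defs hiding (sym)
open import Data.Nat using (ℕ; zero; suc; _≤_; _<_; _*_; _∸_; _+_; _⊔_; z≤n; s≤s)
open import Data.Nat.Properties
open import Data.Nat.ListAction using (sum)
open import Data.Nat.ListAction.Properties using (sum-++)
open import Data.List using (List; []; _∷_; _++_; map; concat; upTo; length; replicate; foldr)
open import Data.List.Properties using (length-++; length-map; length-replicate; ++-assoc; ++-identityʳ; map-++; map-cong-local; foldr-forcesᵇ; foldr-preservesᵇ)
open import Data.List.Relation.Unary.All using (All)
open import Data.List.Relation.Unary.All.Properties using (map⁺; map⁻; applyUpTo⁺₁; applyUpTo⁻)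
open import Data.Bool using (Bool; true; false)
open import Data.Product using (_×_; ∃; Σ-syntax; _,_; proj₁; proj₂)
open import Data.Sum using (inj₁; inj₂)
open import Function using (_∘_)
open import Function.Bundles using (_⇔_; mk⇔; Equivalence)
open import Relation.Binary.PropositionalEquality

module _ {A : Set} where

  length-++-≥ˡ : (xs ys : List A) → length xs ≤ length (xs ++ ys)
  length-++-≥ˡ xs ys = subst (length xs ≤_) (sym (length-++ xs)) (m≤m+n (length xs) (length ys))

  length-++-≥ʳ : (xs ys : List A) → length ys ≤ length (xs ++ ys)
  length-++-≥ʳ xs ys = subst (length ys ≤_) (sym (length-++ xs)) (m≤n+m (length ys) (length xs))

module _ {A : Set} where

  csum-++ : (xs ys : List (A × Bool)) → csum (xs ++ ys) ≡ csum xs + csum ys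
  csum-++ xs ys = trans (cong sum (map-++ _ xs ys)) (sum-++ (map (bit ∘ proj₂) xs) _)

  length-≤-length-block : (K : ℕ) (α : List (A × Bool)) → length α ≤ length (block K α)
  length-≤-length-block K α =
    subst (_≤ length (block K α)) (length-map toHat α) (length-++-≥ˡ (map toHat α) _)

  length-block : (K : ℕ) (α : List (A × Bool)) → length α ≤ K → length (block K α) ≡ K
  length-block K α α≤K = begin
    length (map toHat α ++ replicate (K ∸ length α) dollar)
      ≡⟨ length-++ (map toHat α) ⟩
    length (map toHat α) + length (replicate (K ∸ length α) dollar)
      ≡⟨ cong₂ _+_ (length-map toHat α) (length-replicate (K ∸ length α)) ⟩
    length α + (K ∸ length α)
      ≡⟨ m+[n∸m]≡n α≤K ⟩
    K ∎
    where open ≡-Reasoning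

foldr-⊔-≤⇔ : (K : ℕ) (xs : List ℕ) → foldr _⊔_ 0 xs ≤ K ⇔ All (_≤ K) xs
foldr-⊔-≤⇔ K xs = mk⇔
  (foldr-forcesᵇ (λ m n m⊔n≤K → m⊔n≤o⇒m≤o m n m⊔n≤K , m⊔n≤o⇒n≤o m n m⊔n≤K) 0 xs)
  (foldr-preservesᵇ ⊔-lub z≤n)

module _ {A : Set} where

  level-nonempty : (t : Tree A) (ℓ : ℕ) → ℓ ≤ height t → 1 ≤ length (level t ℓ)
  level-nonempty t zero _ = s≤s z≤n
  level-nonempty (node _ l r) (suc ℓ) (s≤s ℓ≤h) with ≤-total (height l) (height r)
  ... | inj₁ hl≤hr = ≤-trans (level-nonempty r ℓ (subst (ℓ ≤_) (m≤n⇒m⊔n≡n hl≤hr) ℓ≤h))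
                             (length-++-≥ʳ (level l ℓ) _)
  ... | inj₂ hr≤hl = ≤-trans (level-nonempty l ℓ (subst (ℓ ≤_) (m≥n⇒m⊔n≡m hr≤hl) ℓ≤h))
                             (length-++-≥ˡ (level l ℓ) (level r ℓ))

  level-above-height : (t : Tree A) (ℓ : ℕ) → height t < ℓ → level t ℓ ≡ []
  level-above-height (leaf _) (suc ℓ) _ = refl
  level-above-height (node _ l r) (suc ℓ) (s≤s h<ℓ) =
    cong₂ _++_ (level-above-height l ℓ (m⊔n<o⇒m<o (height l) (height r) h<ℓ))
               (level-above-height r ℓ (m⊔n<o⇒n<o (height l) (height r) h<ℓ))

  height-unique : (t : Tree A) (n : ℕ) → level t (suc n) ≡ [] → 1 ≤ length (level t n) → height t ≡ n
  height-unique t n beyond nonempty = ≤-antisym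
    (≮⇒≥ λ n<h → n≮0 (subst (λ xs → 1 ≤ length xs) beyond (level-nonempty t (suc n) n<h)))
    (≮⇒≥ λ h<n → n≮0 (subst (λ xs → 1 ≤ length xs) (level-above-height t n h<n) nonempty))

  length-level-suc : (t : Tree A) (ℓ : ℕ) → length (level t (suc ℓ)) ≡ 2 * csum (level t ℓ)
  length-level-suc (leaf _) zero = refl
  length-level-suc (node _ _ _) zero = refl
  length-level-suc (leaf _) (suc ℓ) = refl
  length-level-suc (node _ l r) (suc ℓ) = begin
    length (level l (suc ℓ) ++ level r (suc ℓ))
      ≡⟨ length-++ (level l (suc ℓ)) ⟩
    length (level l (suc ℓ)) + length (level r (suc ℓ))
      ≡⟨ cong₂ _+_ (length-level-suc l ℓ) (length-level-suc r ℓ) ⟩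
    2 * csum (level l ℓ) + 2 * csum (level r ℓ)
      ≡⟨ *-distribˡ-+ 2 (csum (level l ℓ)) (csum (level r ℓ)) ⟨
    2 * (csum (level l ℓ) + csum (level r ℓ))
      ≡⟨ cong (2 *_) (csum-++ (level l ℓ) (level r ℓ)) ⟨
    2 * csum (level l ℓ ++ level r ℓ) ∎
    where open ≡-Reasoning

  csum-level-height : (t : Tree A) → csum (level t (height t)) ≡ 0
  csum-level-height t = m+n≡0⇒m≡0 _ (begin
    2 * csum (level t (height t))  ≡⟨ length-level-suc t (height t) ⟨
    length (level t (suc (height t)))  ≡⟨ cong length (level-above-height t (suc (height t)) ≤-refl) ⟩
    0 ∎)
    where open ≡-Reasoning

  thickness-≤⇔ : (K : ℕ) (t : Tree A) →
    thickness t ≤ K ⇔ (∀ ℓ → ℓ ≤ height t → length (level t ℓ) ≤ K)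
  thickness-≤⇔ K t = mk⇔
    (λ thin ℓ ℓ≤h → applyUpTo⁻ (λ ℓ → ℓ) (suc (height t))
                      (map⁻ (Equivalence.to (foldr-⊔-≤⇔ K levelSizes) thin)) (s≤s ℓ≤h))
    (λ bounded → Equivalence.from (foldr-⊔-≤⇔ K levelSizes)
                   (map⁺ (applyUpTo⁺₁ (λ ℓ → ℓ) (suc (height t)) (bounded _ ∘ ≤-pred))))
    where
    levelSizes : List ℕ
    levelSizes = map (λ ℓ → length (level t ℓ)) (upTo (suc (height t)))

  root : Tree A → A × Bool
  root t = label t , hasChildren t

  forestLevel : List (Tree A) → ℕ → List (A × Bool)
  forestLevel []       ℓ = []
  forestLevel (t ∷ ts) ℓ = level t ℓ ++ forestLevel ts ℓ

  children : List (Tree A) → List (Tree A)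
  children []                 = []
  children (leaf _ ∷ ts)      = children ts
  children (node _ l r ∷ ts)  = l ∷ r ∷ children ts

  forestLevel-zero : (ts : List (Tree A)) → forestLevel ts 0 ≡ map root ts
  forestLevel-zero []       = refl
  forestLevel-zero (t ∷ ts) = cong (root t ∷_) (forestLevel-zero ts)

  forestLevel-suc : (ts : List (Tree A)) (ℓ : ℕ) → forestLevel ts (suc ℓ) ≡ forestLevel (children ts) ℓ
  forestLevel-suc []                ℓ = refl
  forestLevel-suc (leaf _ ∷ ts)     ℓ = forestLevel-suc ts ℓ
  forestLevel-suc (node _ l r ∷ ts) ℓ =
    trans (++-assoc (level l ℓ) (level r ℓ) _)
          (cong (λ rest → level l ℓ ++ (level r ℓ ++ rest)) (forestLevel-suc ts ℓ))

  forestLevel-singleton : (t : Tree A) (ℓ : ℕ) → forestLevel (t ∷ []) ℓ ≡ level t ℓ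
  forestLevel-singleton t ℓ = ++-identityʳ (level t ℓ)

  length-forestLevel-zero : (ts : List (Tree A)) → length (forestLevel ts 0) ≡ length ts
  length-forestLevel-zero ts = trans (cong length (forestLevel-zero ts)) (length-map root ts)

  -- The last clause is junk: it is never reached when the forest has 2 * csum α trees.
  graft : List (A × Bool) → List (Tree A) → List (Tree A)
  graft []                 F           = []
  graft ((a , false) ∷ α)  F           = leaf a ∷ graft α F
  graft ((a , true)  ∷ α)  (l ∷ r ∷ F) = node a l r ∷ graft α F
  graft ((a , true)  ∷ α)  _           = leaf a ∷ graft α []

  graft-spec : (α : List (A × Bool)) (F : List (Tree A)) → length F ≡ 2 * csum α →
    map root (graft α F) ≡ α × children (graft α F) ≡ F
  graft-spec []                [] _ = refl , refl
  graft-spec ((a , false) ∷ α) F  eq with graft-spec α F eq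
  ... | roots , kids = cong ((a , false) ∷_) roots , kids
  graft-spec ((a , true) ∷ α) F eq with F | trans eq (*-suc 2 (csum α))
  ... | l ∷ r ∷ F′ | eq′ with graft-spec α F′ (suc-injective (suc-injective eq′))
  ...   | roots , kids = cong ((a , true) ∷_) roots , cong (λ G → l ∷ r ∷ G) kids

  forestOf : ℕ → (ℕ → List (A × Bool)) → List (Tree A)
  forestOf zero    α = graft (α 0) []
  forestOf (suc n) α = graft (α 0) (forestOf n (α ∘ suc))

  forestOf-levels : (n : ℕ) (α : ℕ → List (A × Bool)) →
    (∀ ℓ → ℓ < n → length (α (suc ℓ)) ≡ 2 * csum (α ℓ)) → csum (α n) ≡ 0 →
    (∀ ℓ → ℓ ≤ n → forestLevel (forestOf n α) ℓ ≡ α ℓ) × forestLevel (forestOf n α) (suc n) ≡ []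
  forestOf-levels zero α _ last = levels , beyond
    where
    spec : map root (forestOf 0 α) ≡ α 0 × children (forestOf 0 α) ≡ []
    spec = graft-spec (α 0) [] (sym (cong (2 *_) last))
    levels : ∀ ℓ → ℓ ≤ 0 → forestLevel (forestOf 0 α) ℓ ≡ α ℓ
    levels zero _ = trans (forestLevel-zero (forestOf 0 α)) (proj₁ spec)
    beyond : forestLevel (forestOf 0 α) 1 ≡ []
    beyond = trans (forestLevel-suc (forestOf 0 α) 0) (cong (λ F → forestLevel F 0) (proj₂ spec))
  forestOf-levels (suc n) α counts last = levels , beyond
    where
    below : List (Tree A)
    below = forestOf n (α ∘ suc)
    IH : (∀ ℓ → ℓ ≤ n → forestLevel below ℓ ≡ α (suc ℓ)) × forestLevel below (suc n) ≡ []
    IH = forestOf-levels n (α ∘ suc) (λ ℓ → counts (suc ℓ) ∘ s≤s) last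
    length-below : length below ≡ length (α 1)
    length-below = trans (sym (length-forestLevel-zero below)) (cong length (proj₁ IH 0 z≤n))
    spec : map root (forestOf (suc n) α) ≡ α 0 × children (forestOf (suc n) α) ≡ below
    spec = graft-spec (α 0) below (trans length-below (counts 0 (s≤s z≤n)))
    levels : ∀ ℓ → ℓ ≤ suc n → forestLevel (forestOf (suc n) α) ℓ ≡ α ℓ
    levels zero    _         = trans (forestLevel-zero (forestOf (suc n) α)) (proj₁ spec)
    levels (suc ℓ) (s≤s ℓ≤n) = trans (forestLevel-suc (forestOf (suc n) α) ℓ)
      (trans (cong (λ F → forestLevel F ℓ) (proj₂ spec)) (proj₁ IH ℓ ℓ≤n))
    beyond : forestLevel (forestOf (suc n) α) (suc (suc n)) ≡ []
    beyond = trans (forestLevel-suc (forestOf (suc n) α) (suc n))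
      (trans (cong (λ F → forestLevel F (suc n)) (proj₂ spec)) (proj₂ IH))

  reconstruct : (n : ℕ) (α : ℕ → List (A × Bool)) → length (α 0) ≡ 1 →
    (∀ ℓ → ℓ < n → length (α (suc ℓ)) ≡ 2 * csum (α ℓ)) → csum (α n) ≡ 0 →
    ∃ λ (t : Tree A) → (∀ ℓ → ℓ ≤ n → level t ℓ ≡ α ℓ) × level t (suc n) ≡ []
  reconstruct n α one counts last = fromSingleton (forestOf n α) single levels beyond
    where
    levels : ∀ ℓ → ℓ ≤ n → forestLevel (forestOf n α) ℓ ≡ α ℓ
    levels = proj₁ (forestOf-levels n α counts last)
    beyond : forestLevel (forestOf n α) (suc n) ≡ []
    beyond = proj₂ (forestOf-levels n α counts last)
    single : length (forestOf n α) ≡ 1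
    single = trans (sym (length-forestLevel-zero (forestOf n α))) (trans (cong length (levels 0 z≤n)) one)
    fromSingleton : (ts : List (Tree A)) → length ts ≡ 1 →
      (∀ ℓ → ℓ ≤ n → forestLevel ts ℓ ≡ α ℓ) → forestLevel ts (suc n) ≡ [] →
      ∃ λ (t : Tree A) → (∀ ℓ → ℓ ≤ n → level t ℓ ≡ α ℓ) × level t (suc n) ≡ []
    fromSingleton (t ∷ []) _ lv bd =
      t , (λ ℓ ℓ≤n → trans (sym (forestLevel-singleton t ℓ)) (lv ℓ ℓ≤n))
        , trans (sym (forestLevel-singleton t (suc n))) bd

  WellFormed : ℕ → List (Hat A) → Set
  WellFormed K σ =
    Σ[ n ∈ ℕ ] Σ[ σs ∈ (ℕ → List (Hat A)) ] Σ[ α ∈ (ℕ → List (A × Bool)) ]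
      ( σ ≡ concat (map σs (upTo (suc n)))
      × (∀ ℓ → ℓ ≤ n → length (σs ℓ) ≡ K)
      × (∀ ℓ → ℓ ≤ n → 1 ≤ length (α ℓ) × σs ℓ ≡ map toHat (α ℓ) ++ replicate (K ∸ length (α ℓ)) dollar)
      × length (α 0) ≡ 1
      × (∀ ℓ → ℓ < n → length (α (suc ℓ)) ≡ 2 * csum (α ℓ))
      × csum (α n) ≡ 0)

  encode-wellFormed : (K : ℕ) (t : Tree A) → thickness t ≤ K → WellFormed K (encode K t)
  encode-wellFormed K t thin =
    height t , block K ∘ level t , level t , refl
    , (λ ℓ ℓ≤h → length-block K (level t ℓ) (Equivalence.to (thickness-≤⇔ K t) thin ℓ ℓ≤h))
    , (λ ℓ ℓ≤h → level-nonempty t ℓ ℓ≤h , refl)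
    , refl , (λ ℓ _ → length-level-suc t ℓ) , csum-level-height t

  wellFormed-decode : (K : ℕ) (σ : List (Hat A)) → WellFormed K σ →
    ∃ λ (t : Tree A) → thickness t ≤ K × encode K t ≡ σ
  wellFormed-decode K σ (n , σs , α , refl , blockLength , blocks , one , counts , last)
    with reconstruct n α one counts last
  ... | t , levels , beyond = t , thin , encodes
    where
    h≡n : height t ≡ n
    h≡n = height-unique t n beyond
            (subst (λ β → 1 ≤ length β) (sym (levels n ≤-refl)) (proj₁ (blocks n ≤-refl)))
    block-level : ∀ ℓ → ℓ ≤ n → block K (level t ℓ) ≡ σs ℓ
    block-level ℓ ℓ≤n = trans (cong (block K) (levels ℓ ℓ≤n)) (sym (proj₂ (blocks ℓ ℓ≤n)))
    thin : thickness t ≤ K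
    thin = Equivalence.from (thickness-≤⇔ K t) λ ℓ ℓ≤h →
      let ℓ≤n = subst (ℓ ≤_) h≡n ℓ≤h in
      subst (length (level t ℓ) ≤_) (trans (cong length (block-level ℓ ℓ≤n)) (blockLength ℓ ℓ≤n))
        (length-≤-length-block K (level t ℓ))
    encodes : encode K t ≡ concat (map σs (upTo (suc n)))
    encodes = begin
      concat (map (block K ∘ level t) (upTo (suc (height t))))
        ≡⟨ cong (λ m → concat (map (block K ∘ level t) (upTo (suc m)))) h≡n ⟩
      concat (map (block K ∘ level t) (upTo (suc n)))
        ≡⟨ cong concat (map-cong-local (applyUpTo⁺₁ (λ ℓ → ℓ) (suc n) (block-level _ ∘ ≤-pred))) ⟩
      concat (map σs (upTo (suc n))) ∎
      where open ≡-Reasoning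

lemma4p5 : (Σ : Set) → Finite Σ → (K : ℕ) → 1 ≤ K → (σ : List (Hat Σ)) →
    (∃ λ (t : Tree Σ) → thickness t ≤ K × encode K t ≡ σ)
    ⇔
    (Σ[ n ∈ ℕ ] Σ[ σs ∈ (ℕ → List (Hat Σ)) ] Σ[ α ∈ (ℕ → List (Σ × Bool)) ]
      ( σ ≡ concat (map σs (upTo (suc n)))
      × (∀ ℓ → ℓ ≤ n → length (σs ℓ) ≡ K)
      × (∀ ℓ → ℓ ≤ n → 1 ≤ length (α ℓ) × σs ℓ ≡ map toHat (α ℓ) ++ replicate (K ∸ length (α ℓ)) dollar)
      × length (α 0) ≡ 1
      × (∀ ℓ → ℓ < n → length (α (suc ℓ)) ≡ 2 * csum (α ℓ))
      × csum (α n) ≡ 0))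
lemma4p5 Σ _ K _ σ = mk⇔
  (λ { (t , thin , refl) → encode-wellFormed K t thin })
  (wellFormed-decode K σ)
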